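{- Let $\alpha=(\alpha_1,\alpha_2,\ldots,\alpha_\ell)$ be a composition with $\ell>0$, and let $\overline{\alpha}=(\alpha_2,\alpha_3,\ldots,\alpha_\ell)$. Then \[ \mathfrak{S}^*_\alpha=h_{\alpha_1}\prec\mathfrak{S}^*_{\overline{\alpha}}. \]
   Context: Let $\mathbf{k}$ be a commutative ring and $\mathbf{k}[[x_1,x_2,\ldots]]$ the ring of formal power series in commuting indeterminates, with the product topology. For a monomial $\mathfrak m=x_1^{a_1}x_2^{a_2}\cdots$, $\mathrm{Supp}\,\mathfrak m=\{i:a_i>0\}$, with $\min\varnothing=\infty$. $\prec$ is the unique $\mathbf{k}$-bilinear continuous binary operation with $\mathfrak m\prec\mathfrak n=\mathfrak m\mathfrak n$ if $\min(\mathrm{Supp}\,\mathfrak m)<\min(\mathrm{Supp}\,\mathfrak n)$ and $0$ otherwise. $h_n=\sum_{1\le i_1\le\cdots\le i_n}x_{i_1}\cdots x_{i_n}$. A composition is a finite sequence of positive integers, $|\alpha|$ its sum; $M_\beta=\sum_{1\le i_1<\cdots<i_k}x_{i_1}^{\beta_1}\cdots x_{i_k}^{\beta_k}$. For $\alpha=(\alpha_1,\ldots,\alpha_\ell)$, $Y(\alpha)=\{(i,j):1\le i\le\ell,1\le j\le\alpha_i\}$; an immaculate tableau of shape $\alpha$ is a map $T:Y(\alpha)\to\{1,2,\ldots\}$ with $T(i,1)<T(j,1)$ for $i<j$ and $T(i,u)\le T(i,v)$ for $u<v$. $T$ has content $\beta=(\beta_1,\ldots,\beta_k)$ if $|T^{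 -1}(j)|=\beta_j$ for $j\le k$ and $0$ for $j>k$; $K_{\alpha,\beta}$ is the number of immaculate tableaux of shape $\alpha$ and content $\beta$; $\mathfrak{S}^*_\alpha=\sum_\beta K_{\alpha,\beta}M_\beta$ over compositions $\beta$ of $|\alpha|$ (so $\mathfrak S^*_\varnothing=1$). -}

module Defs where

open import Level using (Level)
open import Data.Bool using (Bool; true; false; _∧_; if_then_else_)
open import Data.Nat using (ℕ; zero; suc; _∸_; _<_; _≡ᵇ_; _≤ᵇ_; _<ᵇ_)
open import Data.List using (List; []; _∷_; map; concatMap; upTo; length; concat; foldr)
open import Data.Nat.ListAction using (sum)
open import Data.List.Relation.Unary.All using (All)
open import Data.Maybe using (Maybe; just; nothing)
open import Data.Product using (_×_; _,_)
open import Algebra.Bundles using (CommutativeRing)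

-- A monomial x_1^{a_1} x_2^{a_2} ... is encoded by its exponent list
-- (a_1, a_2, ..., a_n) (implicitly followed by zeros); list position 0
-- corresponds to x_1.  Trailing zeros do not change the monomial, and all
-- coefficient functions defined below are invariant under them.
-- A formal power series in k[[x_1,x_2,...]] is its coefficient function.

Monomial : Set
Monomial = List ℕ

IsComposition : List ℕ → Set
IsComposition α = All (λ x → 0 < x) α

oneTo : ℕ → List ℕ
oneTo n = map suc (upTo n)

vecs : ℕ → List ℕ → List (List ℕ)
vecs zero    vals = [] ∷ []
vecs (suc l) vals = concatMap (λ v → map (v ∷_) (vecs l vals)) vals

filterB : {A : Set} → (A → Bool) → List A → List A
filterB p [] = []
filterB p (x ∷ xs) = if p x then x ∷ filterB p xs else filterB p xs

countB : {A : Set} → (A → Bool) → List A → ℕ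
countB p xs = length (filterB p xs)

compositionsOf : ℕ → List (List ℕ)
compositionsOf n =
  filterB (λ β → sum β ≡ᵇ n) (concatMap (λ l → vecs l (oneTo n)) (upTo (suc n)))

eqListᵇ : List ℕ → List ℕ → Bool
eqListᵇ []       []       = true
eqListᵇ (x ∷ xs) (y ∷ ys) = (x ≡ᵇ y) ∧ eqListᵇ xs ys
eqListᵇ _        _        = false

compress : Monomial → List ℕ
compress []          = []
compress (zero ∷ e)  = compress e
compress (suc a ∷ e) = suc a ∷ compress e

-- Immaculate tableaux.  A filling of Y(α) is a list of rows, row i being
-- the list (T(i,1), ..., T(i,α_i)).

weaklyIncr : List ℕ → Bool
weaklyIncr []           = true
weaklyIncr (x ∷ [])     = true
weaklyIncr (x ∷ y ∷ xs) = (x ≤ᵇ y) ∧ weaklyIncr (y ∷ xs)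

strictlyIncr : List ℕ → Bool
strictlyIncr []           = true
strictlyIncr (x ∷ [])     = true
strictlyIncr (x ∷ y ∷ xs) = (x <ᵇ y) ∧ strictlyIncr (y ∷ xs)

firstColumn : List (List ℕ) → List ℕ
firstColumn []             = []
firstColumn ([] ∷ rs)      = firstColumn rs
firstColumn ((x ∷ _) ∷ rs) = x ∷ firstColumn rs

allRowsWeaklyIncr : List (List ℕ) → Bool
allRowsWeaklyIncr []       = true
allRowsWeaklyIncr (r ∷ rs) = weaklyIncr r ∧ allRowsWeaklyIncr rs

contentFrom : ℕ → List ℕ → List ℕ → Bool
contentFrom j []      xs = true
contentFrom j (b ∷ β) xs = (countB (λ x → x ≡ᵇ j) xs ≡ᵇ b) ∧ contentFrom (suc j) β xs

fillings : List ℕ → List ℕ → List (List (List ℕ))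
fillings []      vals = [] ∷ []
fillings (a ∷ α) vals = concatMap (λ r → map (r ∷_) (fillings α vals)) (vecs a vals)

-- immaculate tableau of content β (entries > length β are excluded by the
-- enumeration below, as content β forces |T^{-1}(j)| = 0 for j > length β)
isImmaculateOfContent : List ℕ → List (List ℕ) → Bool
isImmaculateOfContent β T =
  strictlyIncr (firstColumn T) ∧ allRowsWeaklyIncr T ∧ contentFrom 1 β (concat T)

K : List ℕ → List ℕ → ℕ
K α β = countB (isImmaculateOfContent β) (fillings α (oneTo (length β)))

-- min Supp, with nothing = ∞ ; the test min Supp m < min Supp n

minSupp : Monomial → Maybe ℕ
minSupp []          = nothing
minSupp (zero ∷ e)  = Data.Maybe.map suc (minSupp e)
minSupp (suc _ ∷ e) = just 0

minSuppLt : Maybe ℕ → Maybe ℕ → Bool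
minSuppLt (just a) (just b) = a <ᵇ b
minSuppLt (just a) nothing  = true
minSuppLt nothing  _        = false

splits : Monomial → List (Monomial × Monomial)
splits []      = ([] , []) ∷ []
splits (a ∷ e) =
  concatMap (λ i → map (λ { (p , q) → (i ∷ p , (a ∸ i) ∷ q) }) (splits e)) (upTo (suc a))

module PowerSeries {c ℓ : Level} (R : CommutativeRing c ℓ) where
  open CommutativeRing R

  PS : Set c
  PS = Monomial → Carrier

  _≐_ : PS → PS → Set ℓ
  f ≐ g = (e : Monomial) → f e ≈ g e

  sumR : List Carrier → Carrier
  sumR = foldr _+_ 0#

  fromℕ : ℕ → Carrier
  fromℕ zero    = 0#
  fromℕ (suc n) = 1# + fromℕ n

  h : ℕ → PS
  h n e = if sum e ≡ᵇ n then 1# else 0#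

  M : List ℕ → PS
  M β e = if eqListᵇ (compress e) β then 1# else 0#

  S* : List ℕ → PS
  S* α e = sumR (map (λ β → fromℕ (K α β) * M β e) (compositionsOf (sum α)))

  _≺_ : PS → PS → PS
  (f ≺ g) e = sumR (map (λ { (p , q) → if minSuppLt (minSupp p) (minSupp q) then f p * g q else 0# })
                        (splits e))

-- All coefficients involved are natural numbers, so it suffices to compare them in ℕ.
-- Deleting the first row of an immaculate tableau of shape α and content β leaves an
-- immaculate tableau of shape ᾱ; writing β = p + q for the contents of the row and of
-- the rest, the row is the unique weakly increasing word of content p (so |p| = α₁), and
-- the first-column condition T(1,1) < T(2,1) says exactly min Supp p < min Supp q. Hence
--   K_{α,β} = Σ_{p + q = β, |p| = α₁, min Supp p < min Supp q} K_{ᾱ,q},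
-- which is the coefficientwise form of h_{α₁} ≺ S*_ᾱ once one knows that K_{α,β} only
-- depends on the nonzero entries of β; the latter follows from the same recursion, since
-- inserting a zero into β shifts the supports without changing their order.

module Submission where

open import Defs
open import Data.Nat using (ℕ)
open import Data.List using (List; _∷_)
open import Algebra.Bundles using (CommutativeRing)

open import Level using (Level)
open import Data.Bool using (Bool; true; false; T; _∧_; if_then_else_)
open import Data.Bool.Properties using (T-∧; T-≡; ∧-zeroʳ)
open import Data.Bool.ListAction using (all)
open import Data.Empty using (⊥-elim)
open import Data.List using ([]; _++_; map; concatMap; concat; length; head; upTo; applyUpTo)
open import Data.List.Properties using (map-∘; map-id; ++-assoc)
open import Data.List.Relation.Unary.All using (All; []; _∷_)
import Data.List.Relation.Unary.All as All
import Data.List.Relation.Unary.All.Properties as All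
open import Data.Maybe using (Maybe; just; nothing)
import Data.Maybe as Maybe
open import Data.Nat using (zero; suc; _+_; _*_; _∸_; _≡ᵇ_; _≤ᵇ_; _<ᵇ_; _≤_; _<_; z≤n; s≤s; z<s; _≤?_)
open import Data.Nat.ListAction using (sum)
open import Data.Nat.Properties
open import Data.Nat.Tactic.RingSolver using (solve-∀)
open import Data.Product using (_×_; _,_; proj₁; proj₂)
open import Data.Sum using (_⊎_; inj₁; inj₂)
open import Data.Unit using (tt)
open import Function using (_∘_)
open import Function.Bundles using (Equivalence)
open import Relation.Nullary using (¬_; yes; no)
open import Relation.Binary.PropositionalEquality

private
  variable
    A B C : Set

𝟙 : Bool → ℕ
𝟙 true  = 1
𝟙 false = 0

𝟙-∧ : ∀ b c → 𝟙 (b ∧ c) ≡ 𝟙 b * 𝟙 c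
𝟙-∧ true  c = sym (+-identityʳ (𝟙 c))
𝟙-∧ false c = refl

T-∧⁻ : ∀ {b c} → T (b ∧ c) → T b × T c
T-∧⁻ = Equivalence.to T-∧

T⇒≡true : ∀ {b} → T b → b ≡ true
T⇒≡true = Equivalence.to T-≡

¬T⇒≡false : ∀ {b} → ¬ T b → b ≡ false
¬T⇒≡false {false} _  = refl
¬T⇒≡false {true}  ¬t = ⊥-elim (¬t tt)

≡ᵇ-refl : ∀ n → (n ≡ᵇ n) ≡ true
≡ᵇ-refl n = T⇒≡true (≡⇒≡ᵇ n n refl)

≢⇒≡ᵇ≡false : ∀ {m n} → m ≢ n → (m ≡ᵇ n) ≡ false
≢⇒≡ᵇ≡false {m} {n} m≢n = ¬T⇒≡false (m≢n ∘ ≡ᵇ⇒≡ m n)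

>⇒≤ᵇ≡false : ∀ {m n} → n < m → (m ≤ᵇ n) ≡ false
>⇒≤ᵇ≡false {m} {n} n<m = ¬T⇒≡false (<⇒≱ n<m ∘ ≤ᵇ⇒≤ m n)

∑ : List A → (A → ℕ) → ℕ
∑ []       f = 0
∑ (x ∷ xs) f = f x + ∑ xs f

infix 5 ∑
syntax ∑ xs (λ x → e) = ∑[ x ∈ xs ] e

∑-++ : ∀ (xs ys : List A) f → ∑ (xs ++ ys) f ≡ ∑ xs f + ∑ ys f
∑-++ []       ys f = refl
∑-++ (x ∷ xs) ys f = trans (cong (f x +_) (∑-++ xs ys f)) (sym (+-assoc (f x) _ _))

∑-map : ∀ (g : A → B) xs f → ∑ (map g xs) f ≡ ∑[ x ∈ xs ] f (g x)
∑-map g []       f = refl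
∑-map g (x ∷ xs) f = cong (f (g x) +_) (∑-map g xs f)

∑-concatMap : ∀ (g : A → List B) xs f → ∑ (concatMap g xs) f ≡ ∑[ x ∈ xs ] ∑ (g x) f
∑-concatMap g []       f = refl
∑-concatMap g (x ∷ xs) f =
  trans (∑-++ (g x) (concatMap g xs) f) (cong (∑ (g x) f +_) (∑-concatMap g xs f))

∑-cong : ∀ (xs : List A) {f g} → (∀ x → f x ≡ g x) → ∑ xs f ≡ ∑ xs g
∑-cong []       f≗g = refl
∑-cong (x ∷ xs) f≗g = cong₂ _+_ (f≗g x) (∑-cong xs f≗g)

∑-cong-All : ∀ {P : A → Set} {xs f g} → All P xs → (∀ x → P x → f x ≡ g x) → ∑ xs f ≡ ∑ xs g
∑-cong-All []         f≗g = refl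
∑-cong-All (px ∷ pxs) f≗g = cong₂ _+_ (f≗g _ px) (∑-cong-All pxs f≗g)

∑-zero : ∀ (xs : List A) → ∑[ x ∈ xs ] 0 ≡ 0
∑-zero []       = refl
∑-zero (x ∷ xs) = ∑-zero xs

∑-+ : ∀ (xs : List A) f g → ∑[ x ∈ xs ] (f x + g x) ≡ ∑ xs f + ∑ xs g
∑-+ []       f g = refl
∑-+ (x ∷ xs) f g = trans (cong (f x + g x +_) (∑-+ xs f g)) (interchange (f x) (g x) _ _)
  where
  interchange : ∀ a b c d → a + b + (c + d) ≡ a + c + (b + d)
  interchange = solve-∀

∑-*ˡ : ∀ (xs : List A) c f → ∑[ x ∈ xs ] (c * f x) ≡ c * ∑ xs f
∑-*ˡ []       c f = sym (*-zeroʳ c)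
∑-*ˡ (x ∷ xs) c f = trans (cong (c * f x +_) (∑-*ˡ xs c f)) (sym (*-distribˡ-+ c (f x) _))

∑-*ʳ : ∀ (xs : List A) c f → ∑[ x ∈ xs ] (f x * c) ≡ ∑ xs f * c
∑-*ʳ xs c f = trans (∑-cong xs (λ x → *-comm (f x) c)) (trans (∑-*ˡ xs c f) (*-comm c _))

∑-comm : ∀ (xs : List A) (ys : List B) (f : A → B → ℕ) → ∑[ x ∈ xs ] ∑ ys (f x) ≡ ∑[ y ∈ ys ] ∑[ x ∈ xs ] f x y
∑-comm []       ys f = sym (∑-zero ys)
∑-comm (x ∷ xs) ys f = trans (cong (∑ ys (f x) +_) (∑-comm xs ys f)) (sym (∑-+ ys (f x) _))

∑-filterB : ∀ p (xs : List A) f → ∑ (filterB p xs) f ≡ ∑[ x ∈ xs ] (𝟙 (p x) * f x)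
∑-filterB p []       f = refl
∑-filterB p (x ∷ xs) f with p x
... | true  = cong₂ _+_ (sym (+-identityʳ (f x))) (∑-filterB p xs f)
... | false = ∑-filterB p xs f

countB≡∑ : ∀ p (xs : List A) → countB p xs ≡ ∑[ x ∈ xs ] 𝟙 (p x)
countB≡∑ p []       = refl
countB≡∑ p (x ∷ xs) with p x
... | true  = cong suc (countB≡∑ p xs)
... | false = countB≡∑ p xs

∑-*-zeroʳ : ∀ (xs : List A) f → ∑[ x ∈ xs ] (f x * 0) ≡ 0
∑-*-zeroʳ xs f = trans (∑-*ʳ xs 0 f) (*-zeroʳ (∑ xs f))

∑-*-∑ : ∀ (xs : List A) (ys : List B) f g → ∑ xs f * ∑ ys g ≡ ∑[ x ∈ xs ] ∑[ y ∈ ys ] (f x * g y)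
∑-*-∑ xs ys f g =
  trans (sym (∑-*ʳ xs (∑ ys g) f)) (∑-cong xs (λ x → sym (∑-*ˡ ys (f x) g)))

∑-factor : ∀ (xs : List A) (ys : List B) (zs : List C) (L : C → ℕ) (f : A → C → ℕ) (g : B → C → ℕ) →
  ∑[ x ∈ xs ] ∑[ y ∈ ys ] ∑[ z ∈ zs ] L z * (f x z * g y z) ≡
  ∑[ z ∈ zs ] L z * ((∑[ x ∈ xs ] f x z) * (∑[ y ∈ ys ] g y z))
∑-factor xs ys zs L f g = begin
  ∑[ x ∈ xs ] ∑[ y ∈ ys ] ∑[ z ∈ zs ] L z * (f x z * g y z)
    ≡⟨ ∑-cong xs (λ x → ∑-comm ys zs _) ⟩
  ∑[ x ∈ xs ] ∑[ z ∈ zs ] ∑[ y ∈ ys ] L z * (f x z * g y z)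
    ≡⟨ ∑-comm xs zs _ ⟩
  ∑[ z ∈ zs ] ∑[ x ∈ xs ] ∑[ y ∈ ys ] L z * (f x z * g y z)
    ≡⟨ ∑-cong zs (λ z → trans (∑-cong xs (λ x → ∑-*ˡ ys (L z) _)) (∑-*ˡ xs (L z) _)) ⟩
  ∑[ z ∈ zs ] L z * (∑[ x ∈ xs ] ∑[ y ∈ ys ] f x z * g y z)
    ≡⟨ ∑-cong zs (λ z → cong (L z *_) (sym (∑-*-∑ xs ys (λ x → f x z) (λ y → g y z)))) ⟩
  ∑[ z ∈ zs ] L z * ((∑[ x ∈ xs ] f x z) * (∑[ y ∈ ys ] g y z)) ∎
  where open ≡-Reasoning

range : ℕ → ℕ → List ℕ
range j zero    = []
range j (suc n) = j ∷ range (suc j) n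

InRange : ℕ → ℕ → ℕ → Set
InRange j n x = j ≤ x × x < j + n

range-All : ∀ j n → All (InRange j n) (range j n)
range-All j zero    = []
range-All j (suc n) = (≤-refl , m<m+n j z<s) ∷ All.map shift (range-All (suc j) n)
  where
  shift : ∀ {x} → InRange (suc j) n x → InRange j (suc n) x
  shift {x} (j<x , x<) = <⇒≤ j<x , subst (x <_) (sym (+-suc j n)) x<

range-suc : ∀ j n → map suc (range j n) ≡ range (suc j) n
range-suc j zero    = refl
range-suc j (suc n) = cong (suc j ∷_) (range-suc (suc j) n)

applyUpTo≡map-range : ∀ (f : ℕ → ℕ) n → applyUpTo f n ≡ map f (range 0 n)
applyUpTo≡map-range f zero    = refl
applyUpTo≡map-range f (suc n) = cong (f 0 ∷_) (begin
  applyUpTo (f ∘ suc) n       ≡⟨ applyUpTo≡map-range (f ∘ suc) n ⟩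
  map (f ∘ suc) (range 0 n)   ≡⟨ map-∘ (range 0 n) ⟩
  map f (map suc (range 0 n)) ≡⟨ cong (map f) (range-suc 0 n) ⟩
  map f (range 1 n)           ∎)
  where open ≡-Reasoning

upTo≡range : ∀ n → upTo n ≡ range 0 n
upTo≡range n = trans (applyUpTo≡map-range (λ x → x) n) (map-id _)

oneTo≡range : ∀ n → oneTo n ≡ range 1 n
oneTo≡range n = trans (cong (map suc) (upTo≡range n)) (range-suc 0 n)

∑-range-indicator-out : ∀ x j m (g : ℕ → ℕ) → x < j ⊎ j + m ≤ x →
  ∑[ i ∈ range j m ] 𝟙 (x ≡ᵇ i) * g i ≡ 0
∑-range-indicator-out x j zero    g _ = refl
∑-range-indicator-out x j (suc m) g out =
  cong₂ _+_ (cong (λ b → 𝟙 b * g j) (≢⇒≡ᵇ≡false (x≢j out)))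
            (∑-range-indicator-out x (suc j) m g (shift out))
  where
  x≢j : x < j ⊎ j + suc m ≤ x → x ≢ j
  x≢j (inj₁ x<j)  = <⇒≢ x<j
  x≢j (inj₂ j+≤x) = >⇒≢ (<-≤-trans (m<m+n j z<s) j+≤x)
  shift : x < j ⊎ j + suc m ≤ x → x < suc j ⊎ suc j + m ≤ x
  shift (inj₁ x<j)  = inj₁ (m<n⇒m<1+n x<j)
  shift (inj₂ j+≤x) = inj₂ (subst (_≤ x) (+-suc j m) j+≤x)

∑-range-indicator-in : ∀ x j m (g : ℕ → ℕ) → InRange j m x →
  ∑[ i ∈ range j m ] 𝟙 (x ≡ᵇ i) * g i ≡ g x
∑-range-indicator-in x j zero    g (j≤x , x<j+0) =
  ⊥-elim (<⇒≱ x<j+0 (subst (_≤ x) (sym (+-identityʳ j)) j≤x))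
∑-range-indicator-in x j (suc m) g (j≤x , x<) with m≤n⇒m<n∨m≡n j≤x
... | inj₁ j<x rewrite ≢⇒≡ᵇ≡false (>⇒≢ j<x) =
  ∑-range-indicator-in x (suc j) m g (j<x , subst (x <_) (+-suc j m) x<)
... | inj₂ refl rewrite ≡ᵇ-refl x
                      | ∑-range-indicator-out x (suc x) m g (inj₁ (n<1+n x)) =
  trans (+-identityʳ _) (+-identityʳ _)

-- Weakly increasing words of a given content

All-concatMap⁺ : ∀ {P : B → Set} {Q : A → Set} {g : A → List B} {xs} →
  (∀ {x} → Q x → All P (g x)) → All Q xs → All P (concatMap g xs)
All-concatMap⁺ f qs = All.concat⁺ (All.map⁺ (All.map f qs))

vecs-All : ∀ {Q : ℕ → Set} a {V} → All Q V → All (λ r → length r ≡ a × All Q r) (vecs a V)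
vecs-All zero    qV = (refl , []) ∷ []
vecs-All (suc a) qV =
  All-concatMap⁺ (λ qv → All.map⁺ (All.map (λ (len , qw) → cong suc len , qv ∷ qw) (vecs-All a qV))) qV

∑-vecs-suc : ∀ a V (F : List ℕ → ℕ) → ∑ (vecs (suc a) V) F ≡ ∑[ v ∈ V ] ∑[ w ∈ vecs a V ] F (v ∷ w)
∑-vecs-suc a V F = trans (∑-concatMap _ V F) (∑-cong V (λ v → ∑-map (v ∷_) (vecs a V) F))

∑-vecs-all : ∀ p a V (G : List ℕ → ℕ) →
  ∑[ w ∈ vecs a V ] 𝟙 (all p w) * G w ≡ ∑ (vecs a (filterB p V)) G
∑-vecs-all p zero    V G = cong (_+ 0) (+-identityʳ (G []))
∑-vecs-all p (suc a) V G = begin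
  ∑[ w ∈ vecs (suc a) V ] 𝟙 (all p w) * G w
    ≡⟨ ∑-vecs-suc a V _ ⟩
  ∑[ v ∈ V ] ∑[ w ∈ vecs a V ] 𝟙 (p v ∧ all p w) * G (v ∷ w)
    ≡⟨ ∑-cong V (λ v → trans (∑-cong (vecs a V) (λ w → split v w)) (∑-*ˡ (vecs a V) (𝟙 (p v)) _)) ⟩
  ∑[ v ∈ V ] 𝟙 (p v) * (∑[ w ∈ vecs a V ] 𝟙 (all p w) * G (v ∷ w))
    ≡⟨ ∑-cong V (λ v → cong (𝟙 (p v) *_) (∑-vecs-all p a V (G ∘ (v ∷_)))) ⟩
  ∑[ v ∈ V ] 𝟙 (p v) * ∑ (vecs a (filterB p V)) (G ∘ (v ∷_))
    ≡⟨ sym (∑-filterB p V _) ⟩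
  ∑[ v ∈ filterB p V ] ∑ (vecs a (filterB p V)) (G ∘ (v ∷_))
    ≡⟨ sym (∑-vecs-suc a (filterB p V) G) ⟩
  ∑ (vecs (suc a) (filterB p V)) G ∎
  where
  open ≡-Reasoning
  split : ∀ v w → 𝟙 (p v ∧ all p w) * G (v ∷ w) ≡ 𝟙 (p v) * (𝟙 (all p w) * G (v ∷ w))
  split v w = trans (cong (_* G (v ∷ w)) (𝟙-∧ (p v) (all p w))) (*-assoc (𝟙 (p v)) _ _)

filterB-all : ∀ (p : A → Bool) {xs} → All (T ∘ p) xs → filterB p xs ≡ xs
filterB-all p []                 = refl
filterB-all p {x ∷ _} (px ∷ pxs) rewrite T⇒≡true px = cong (x ∷_) (filterB-all p pxs)

all-≤ᵇ-mono : ∀ {v x} w → v ≤ x → T (all (x ≤ᵇ_) w) → T (all (v ≤ᵇ_) w)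
all-≤ᵇ-mono {v} {x} w v≤x t =
  All.all⁻ (v ≤ᵇ_) (All.map (λ {y} x≤y → ≤⇒≤ᵇ (≤-trans v≤x (≤ᵇ⇒≤ x y x≤y))) (All.all⁺ (x ≤ᵇ_) w t))

weaklyIncr-∷ : ∀ v w → weaklyIncr (v ∷ w) ≡ all (v ≤ᵇ_) w ∧ weaklyIncr w
weaklyIncr-∷ v []      = refl
weaklyIncr-∷ v (x ∷ w) with v ≤ᵇ x in v≤ᵇx
... | false = refl
... | true  rewrite weaklyIncr-∷ x w = absorb (all (x ≤ᵇ_) w) (weaklyIncr w)
                                         (all-≤ᵇ-mono w (≤ᵇ⇒≤ v x (subst T (sym v≤ᵇx) _)))
  where
  absorb : ∀ b c {d} → (T b → T d) → b ∧ c ≡ d ∧ (b ∧ c)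
  absorb false c b⇒d = sym (∧-zeroʳ _)
  absorb true  c b⇒d rewrite T⇒≡true (b⇒d _) = refl

∑-weaklyIncr-vecs-suc : ∀ a V (F : List ℕ → ℕ) →
  ∑[ r ∈ vecs (suc a) V ] 𝟙 (weaklyIncr r) * F r ≡
  ∑[ v ∈ V ] ∑[ w ∈ vecs a (filterB (v ≤ᵇ_) V) ] 𝟙 (weaklyIncr w) * F (v ∷ w)
∑-weaklyIncr-vecs-suc a V F = trans (∑-vecs-suc a V _) (∑-cong V (λ v →
  trans (∑-cong (vecs a V) (λ w → split v w))
        (∑-vecs-all (v ≤ᵇ_) a V (λ w → 𝟙 (weaklyIncr w) * F (v ∷ w)))))
  where
  split : ∀ v w → 𝟙 (weaklyIncr (v ∷ w)) * F (v ∷ w) ≡ 𝟙 (all (v ≤ᵇ_) w) * (𝟙 (weaklyIncr w) * F (v ∷ w))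
  split v w = begin
    𝟙 (weaklyIncr (v ∷ w)) * F (v ∷ w)                    ≡⟨ cong (λ b → 𝟙 b * F (v ∷ w)) (weaklyIncr-∷ v w) ⟩
    𝟙 (all (v ≤ᵇ_) w ∧ weaklyIncr w) * F (v ∷ w)           ≡⟨ cong (_* F (v ∷ w)) (𝟙-∧ (all (v ≤ᵇ_) w) _) ⟩
    𝟙 (all (v ≤ᵇ_) w) * 𝟙 (weaklyIncr w) * F (v ∷ w)       ≡⟨ *-assoc (𝟙 (all (v ≤ᵇ_) w)) _ _ ⟩
    𝟙 (all (v ≤ᵇ_) w) * (𝟙 (weaklyIncr w) * F (v ∷ w))     ∎
    where open ≡-Reasoning

-- A weakly increasing word over the alphabet j ∷ R, with j below R, either starts
-- with j or does not use j at all.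
∑-weaklyIncr-first-letter : ∀ a j R (F : List ℕ → ℕ) → All (j <_) R →
  ∑[ r ∈ vecs (suc a) (j ∷ R) ] 𝟙 (weaklyIncr r) * F r ≡
  (∑[ w ∈ vecs a (j ∷ R) ] 𝟙 (weaklyIncr w) * F (j ∷ w)) + (∑[ r ∈ vecs (suc a) R ] 𝟙 (weaklyIncr r) * F r)
∑-weaklyIncr-first-letter a j R F j<R =
  trans (∑-weaklyIncr-vecs-suc a (j ∷ R) F)
        (cong₂ _+_ (cong (λ V → ∑[ w ∈ vecs a V ] 𝟙 (weaklyIncr w) * F (j ∷ w)) filter-j)
                   (trans (∑-cong-All j<R (λ v j<v → cong (λ V → ∑[ w ∈ vecs a V ] 𝟙 (weaklyIncr w) * F (v ∷ w))
                                                          (filter-v j<v)))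
                          (sym (∑-weaklyIncr-vecs-suc a R F))))
  where
  filter-j : filterB (j ≤ᵇ_) (j ∷ R) ≡ j ∷ R
  filter-j = filterB-all (j ≤ᵇ_) (≤⇒≤ᵇ (≤-refl {j}) ∷ All.map (≤⇒≤ᵇ ∘ <⇒≤) j<R)
  filter-v : ∀ {v} → j < v → filterB (v ≤ᵇ_) (j ∷ R) ≡ filterB (v ≤ᵇ_) R
  filter-v j<v rewrite >⇒≤ᵇ≡false j<v = refl

countB-≡ᵇ-∷-hit : ∀ j w → countB (_≡ᵇ j) (j ∷ w) ≡ suc (countB (_≡ᵇ j) w)
countB-≡ᵇ-∷-hit j w rewrite ≡ᵇ-refl j = refl

countB-≡ᵇ-∷-miss : ∀ {j x} w → x ≢ j → countB (_≡ᵇ j) (x ∷ w) ≡ countB (_≡ᵇ j) w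
countB-≡ᵇ-∷-miss w x≢j rewrite ≢⇒≡ᵇ≡false x≢j = refl

countB-≡ᵇ-above : ∀ {j} w → All (j <_) w → countB (_≡ᵇ j) w ≡ 0
countB-≡ᵇ-above []      []           = refl
countB-≡ᵇ-above (x ∷ w) (j<x ∷ j<w) = trans (countB-≡ᵇ-∷-miss w (>⇒≢ j<x)) (countB-≡ᵇ-above w j<w)

contentFrom-nil : ∀ j p → contentFrom j p [] ≡ (sum p ≡ᵇ 0)
contentFrom-nil j []          = refl
contentFrom-nil j (zero ∷ p)  = contentFrom-nil (suc j) p
contentFrom-nil j (suc b ∷ p) = refl

contentFrom-skip : ∀ {x} j p w → x < j → contentFrom j p (x ∷ w) ≡ contentFrom j p w
contentFrom-skip j []      w x<j = refl
contentFrom-skip j (b ∷ p) w x<j =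
  cong₂ (λ c d → (c ≡ᵇ b) ∧ d) (countB-≡ᵇ-∷-miss w (<⇒≢ x<j)) (contentFrom-skip (suc j) p w (m<n⇒m<1+n x<j))

contentFrom-∷-head : ∀ j k p w →
  contentFrom j (k ∷ p) (j ∷ w) ≡ (suc (countB (_≡ᵇ j) w) ≡ᵇ k) ∧ contentFrom (suc j) p w
contentFrom-∷-head j k p w =
  cong₂ (λ c d → (c ≡ᵇ k) ∧ d) (countB-≡ᵇ-∷-hit j w) (contentFrom-skip (suc j) p w (n<1+n j))

contentFrom-above : ∀ j k p w → All (j <_) w → contentFrom j (k ∷ p) w ≡ (0 ≡ᵇ k) ∧ contentFrom (suc j) p w
contentFrom-above j k p w j<w = cong (λ c → (c ≡ᵇ k) ∧ contentFrom (suc j) p w) (countB-≡ᵇ-above w j<w)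

∑-weaklyIncr-content-∷ : ∀ j k p a →
  ∑[ r ∈ vecs (suc a) (range j (length (k ∷ p))) ] 𝟙 (weaklyIncr r) * 𝟙 (contentFrom j (k ∷ p) r) ≡
  (∑[ w ∈ vecs a (range j (length (k ∷ p))) ]
     𝟙 (weaklyIncr w) * 𝟙 ((suc (countB (_≡ᵇ j) w) ≡ᵇ k) ∧ contentFrom (suc j) p w)) +
  (∑[ r ∈ vecs (suc a) (range (suc j) (length p)) ]
     𝟙 (weaklyIncr r) * 𝟙 ((0 ≡ᵇ k) ∧ contentFrom (suc j) p r))
∑-weaklyIncr-content-∷ j k p a =
  trans (∑-weaklyIncr-first-letter a j R _ (All.map proj₁ (range-All (suc j) (length p))))
        (cong₂ _+_ (∑-cong (vecs a (j ∷ R)) λ w →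
                      cong (λ b → 𝟙 (weaklyIncr w) * 𝟙 b) (contentFrom-∷-head j k p w))
                   (∑-cong-All (vecs-All (suc a) (range-All (suc j) (length p))) λ r (_ , r∈R) →
                      cong (λ b → 𝟙 (weaklyIncr r) * 𝟙 b) (contentFrom-above j k p r (All.map proj₁ r∈R))))
  where
  R = range (suc j) (length p)

-- There is exactly one weakly increasing word of content p, and its length is sum p.
∑-weaklyIncr-content : ∀ j p a →
  ∑[ r ∈ vecs a (range j (length p)) ] 𝟙 (weaklyIncr r) * 𝟙 (contentFrom j p r) ≡ 𝟙 (sum p ≡ᵇ a)
∑-weaklyIncr-content j p zero rewrite contentFrom-nil j p = trans (+-identityʳ _) (+-identityʳ _)
∑-weaklyIncr-content j []          (suc a) = refl
∑-weaklyIncr-content j (zero ∷ p)  (suc a) =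
  trans (∑-weaklyIncr-content-∷ j zero p a)
        (cong₂ _+_ (∑-*-zeroʳ (vecs a (range j (suc (length p)))) (𝟙 ∘ weaklyIncr))
                   (∑-weaklyIncr-content (suc j) p (suc a)))
∑-weaklyIncr-content j (suc k ∷ p) (suc a) =
  trans (∑-weaklyIncr-content-∷ j (suc k) p a)
        (trans (cong₂ _+_ (∑-weaklyIncr-content j (k ∷ p) a)
                          (∑-*-zeroʳ (vecs (suc a) (range (suc j) (length p))) (𝟙 ∘ weaklyIncr)))
               (+-identityʳ _))

-- Splitting the content of a concatenation

countB-++ : ∀ (p : A → Bool) xs ys → countB p (xs ++ ys) ≡ countB p xs + countB p ys
countB-++ p xs ys =
  trans (countB≡∑ p (xs ++ ys)) (trans (∑-++ xs ys _) (sym (cong₂ _+_ (countB≡∑ p xs) (countB≡∑ p ys))))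

≡ᵇ-∸ : ∀ x y b → x ≤ b → (y ≡ᵇ b ∸ x) ≡ (x + y ≡ᵇ b)
≡ᵇ-∸ zero    y b       x≤b       = refl
≡ᵇ-∸ (suc x) y (suc b) (s≤s x≤b) = ≡ᵇ-∸ x y b x≤b

∑-upTo-≡ᵇ-split : ∀ x y b → ∑[ i ∈ upTo (suc b) ] 𝟙 (x ≡ᵇ i) * 𝟙 (y ≡ᵇ b ∸ i) ≡ 𝟙 (x + y ≡ᵇ b)
∑-upTo-≡ᵇ-split x y b = trans (cong (λ is → ∑[ i ∈ is ] 𝟙 (x ≡ᵇ i) * 𝟙 (y ≡ᵇ b ∸ i)) (upTo≡range (suc b))) pick
  where
  pick : ∑[ i ∈ range 0 (suc b) ] 𝟙 (x ≡ᵇ i) * 𝟙 (y ≡ᵇ b ∸ i) ≡ 𝟙 (x + y ≡ᵇ b)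
  pick with x ≤? b
  ... | yes x≤b = trans (∑-range-indicator-in x 0 (suc b) _ (z≤n , s≤s x≤b)) (cong 𝟙 (≡ᵇ-∸ x y b x≤b))
  ... | no  x≰b rewrite ≢⇒≡ᵇ≡false (>⇒≢ (≤-trans (≰⇒> x≰b) (m≤m+n x y))) =
    ∑-range-indicator-out x 0 (suc b) _ (inj₂ (≰⇒> x≰b))

∑-splits-∷ : ∀ b β (H : List ℕ × List ℕ → ℕ) →
  ∑ (splits (b ∷ β)) H ≡ ∑[ i ∈ upTo (suc b) ] ∑[ (p , q) ∈ splits β ] H (i ∷ p , (b ∸ i) ∷ q)
∑-splits-∷ b β H =
  trans (∑-concatMap (λ i → map (λ (p , q) → i ∷ p , (b ∸ i) ∷ q) (splits β)) (upTo (suc b)) H)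
        (∑-cong (upTo (suc b)) (λ i → ∑-map _ (splits β) H))

𝟙-contentFrom-++ : ∀ j β xs ys → 𝟙 (contentFrom j β (xs ++ ys)) ≡
  ∑[ (p , q) ∈ splits β ] 𝟙 (contentFrom j p xs) * 𝟙 (contentFrom j q ys)
𝟙-contentFrom-++ j []      xs ys = refl
𝟙-contentFrom-++ j (b ∷ β) xs ys = begin
  𝟙 ((countB (_≡ᵇ j) (xs ++ ys) ≡ᵇ b) ∧ contentFrom (suc j) β (xs ++ ys))
    ≡⟨ 𝟙-∧ (countB (_≡ᵇ j) (xs ++ ys) ≡ᵇ b) _ ⟩
  𝟙 (countB (_≡ᵇ j) (xs ++ ys) ≡ᵇ b) * 𝟙 (contentFrom (suc j) β (xs ++ ys))
    ≡⟨ cong₂ _*_ (cong (λ c → 𝟙 (c ≡ᵇ b)) (countB-++ (_≡ᵇ j) xs ys)) (𝟙-contentFrom-++ (suc j) β xs ys) ⟩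
  𝟙 (cx + cy ≡ᵇ b) * ∑ (splits β) G
    ≡⟨ cong (_* ∑ (splits β) G) (sym (∑-upTo-≡ᵇ-split cx cy b)) ⟩
  (∑[ i ∈ upTo (suc b) ] 𝟙 (cx ≡ᵇ i) * 𝟙 (cy ≡ᵇ b ∸ i)) * ∑ (splits β) G
    ≡⟨ ∑-*-∑ (upTo (suc b)) (splits β) (λ i → 𝟙 (cx ≡ᵇ i) * 𝟙 (cy ≡ᵇ b ∸ i)) G ⟩
  ∑[ i ∈ upTo (suc b) ] ∑[ pq ∈ splits β ] (𝟙 (cx ≡ᵇ i) * 𝟙 (cy ≡ᵇ b ∸ i) * G pq)
    ≡⟨ ∑-cong (upTo (suc b)) (λ i → ∑-cong (splits β) (regroup i)) ⟩
  ∑[ i ∈ upTo (suc b) ] ∑[ (p , q) ∈ splits β ] H (i ∷ p , (b ∸ i) ∷ q)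
    ≡⟨ sym (∑-splits-∷ b β H) ⟩
  ∑ (splits (b ∷ β)) H ∎
  where
  open ≡-Reasoning
  cx = countB (_≡ᵇ j) xs
  cy = countB (_≡ᵇ j) ys
  G H : List ℕ × List ℕ → ℕ
  G (p , q) = 𝟙 (contentFrom (suc j) p xs) * 𝟙 (contentFrom (suc j) q ys)
  H (p , q) = 𝟙 (contentFrom j p xs) * 𝟙 (contentFrom j q ys)
  interchange : ∀ a b c d → a * b * (c * d) ≡ a * c * (b * d)
  interchange = solve-∀
  regroup : ∀ i pq → 𝟙 (cx ≡ᵇ i) * 𝟙 (cy ≡ᵇ b ∸ i) * G pq ≡ H (i ∷ proj₁ pq , (b ∸ i) ∷ proj₂ pq)
  regroup i (p , q) = trans (interchange (𝟙 (cx ≡ᵇ i)) _ _ _)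
                            (sym (cong₂ _*_ (𝟙-∧ (cx ≡ᵇ i) _) (𝟙-∧ (cy ≡ᵇ b ∸ i) _)))

IsSplitOf : List ℕ → List ℕ × List ℕ → Set
IsSplitOf β (p , q) = length p ≡ length β × length q ≡ length β × sum p + sum q ≡ sum β

splits-All : ∀ β → All (IsSplitOf β) (splits β)
splits-All []      = (refl , refl , refl) ∷ []
splits-All (b ∷ β) = All-concatMap⁺ (λ i≤b → All.map⁺ (All.map (λ {pq} → extend {pq = pq} i≤b) (splits-All β)))
                                    (All.map (λ i<1+b → ≤-pred i<1+b) (All.all-upTo (suc b)))
  where
  extend : ∀ {i} {pq} → i ≤ b → IsSplitOf β pq → IsSplitOf (b ∷ β) (i ∷ proj₁ pq , (b ∸ i) ∷ proj₂ pq)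
  extend {i} {p , q} i≤b (lp , lq , s) =
    cong suc lp , cong suc lq , trans (interchange i (sum p) (b ∸ i) (sum q)) (cong₂ _+_ (m+[n∸m]≡n i≤b) s)
    where
    interchange : ∀ a b c d → a + b + (c + d) ≡ a + c + (b + d)
    interchange = solve-∀

weaklyIncr-head≤ : ∀ v w → T (weaklyIncr (v ∷ w)) → All (v ≤_) w
weaklyIncr-head≤ v w t rewrite weaklyIncr-∷ v w =
  All.map (λ {x} → ≤ᵇ⇒≤ v x) (All.all⁺ (v ≤ᵇ_) w (proj₁ (T-∧⁻ t)))

-- minSuppLt is the order of ℕ ∪ {∞} with nothing as ∞, so it also compares x with the head of l.
strictlyIncr-∷ : ∀ x l → strictlyIncr (x ∷ l) ≡ minSuppLt (just x) (head l) ∧ strictlyIncr l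
strictlyIncr-∷ x []      = refl
strictlyIncr-∷ x (y ∷ l) = refl

minSuppLt-map : ∀ (f : ℕ → ℕ) → (∀ a b → (f a <ᵇ f b) ≡ (a <ᵇ b)) →
  ∀ m n → minSuppLt (Maybe.map f m) (Maybe.map f n) ≡ minSuppLt m n
minSuppLt-map f mono (just a) (just b) = mono a b
minSuppLt-map f mono (just a) nothing  = refl
minSuppLt-map f mono nothing  n        = refl

minSupp-contentFrom-nil : ∀ j q → T (contentFrom j q []) → minSupp q ≡ nothing
minSupp-contentFrom-nil j q t rewrite contentFrom-nil j q = sum≡0 q (≡ᵇ⇒≡ (sum q) 0 t)
  where
  sum≡0 : ∀ q → sum q ≡ 0 → minSupp q ≡ nothing
  sum≡0 []          _  = refl
  sum≡0 (zero ∷ q)  s  rewrite sum≡0 q s = refl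

minSupp-∷-suc : ∀ {b c} p → b ≡ suc c → minSupp (b ∷ p) ≡ just 0
minSupp-∷-suc p refl = refl

minSupp-∷-zero : ∀ {b} p → b ≡ 0 → minSupp (b ∷ p) ≡ Maybe.map suc (minSupp p)
minSupp-∷-zero p refl = refl

minSupp-contentFrom : ∀ j p x w → InRange j (length p) x → All (x ≤_) w →
  T (contentFrom j p (x ∷ w)) → minSupp p ≡ just (x ∸ j)
minSupp-contentFrom j []      x w (j≤x , x<j+0) _ _ =
  ⊥-elim (<⇒≱ x<j+0 (subst (_≤ x) (sym (+-identityʳ j)) j≤x))
minSupp-contentFrom j (b ∷ p) x w (j≤x , x<) x≤w t
  with T-∧⁻ {countB (_≡ᵇ j) (x ∷ w) ≡ᵇ b} t | m≤n⇒m<n∨m≡n j≤x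
... | count≡b , _ | inj₂ refl =
  trans (minSupp-∷-suc p (trans (sym (≡ᵇ⇒≡ _ b count≡b)) (countB-≡ᵇ-∷-hit j w))) (cong just (sym (n∸n≡0 j)))
... | count≡b , rest | inj₁ j<x = begin
  minSupp (b ∷ p)
    ≡⟨ minSupp-∷-zero p (trans (sym (≡ᵇ⇒≡ _ b count≡b))
                               (countB-≡ᵇ-above (x ∷ w) (j<x ∷ All.map (<-≤-trans j<x) x≤w))) ⟩
  Maybe.map suc (minSupp p)
    ≡⟨ cong (Maybe.map suc)
            (minSupp-contentFrom (suc j) p x w (j<x , subst (x <_) (+-suc j (length p)) x<) x≤w rest) ⟩
  just (suc (x ∸ suc j))
    ≡⟨ cong just (sym (+-∸-assoc 1 j<x)) ⟩
  just (x ∸ j) ∎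
  where open ≡-Reasoning

concat-above-first : ∀ y τ → T (strictlyIncr (y ∷ firstColumn τ)) → T (allRowsWeaklyIncr τ) →
  All (y ≤_) (concat τ)
concat-above-first y []            _ _ = []
concat-above-first y ([] ∷ τ)      s a = concat-above-first y τ s a
concat-above-first y ((z ∷ r) ∷ τ) s a =
  let y<z , column     = T-∧⁻ {y <ᵇ z} s
      row , other-rows = T-∧⁻ {weaklyIncr (z ∷ r)} a
  in All.map (≤-trans (<⇒≤ (<ᵇ⇒< y z y<z)))
             (All.++⁺ (≤-refl ∷ weaklyIncr-head≤ z r row) (concat-above-first z τ column other-rows))

minSupp-weaklyIncr : ∀ p x r → All (InRange 1 (length p)) (x ∷ r) →
  T (weaklyIncr (x ∷ r)) → T (contentFrom 1 p (x ∷ r)) → Maybe.map suc (minSupp p) ≡ just x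
minSupp-weaklyIncr p zero    r ((() , _) ∷ _) w c
minSupp-weaklyIncr p (suc x) r (x∈ ∷ _) w c =
  cong (Maybe.map suc) (minSupp-contentFrom 1 p (suc x) r x∈ (weaklyIncr-head≤ (suc x) r w) c)

minSupp-immaculate : ∀ q τ → All (InRange 1 (length q)) (concat τ) →
  T (isImmaculateOfContent q τ) → Maybe.map suc (minSupp q) ≡ head (firstColumn τ)
minSupp-immaculate q [] _ t rewrite minSupp-contentFrom-nil 1 q t = refl
minSupp-immaculate q ([] ∷ τ) τ∈ t = minSupp-immaculate q τ τ∈ t
minSupp-immaculate q ((zero ∷ r) ∷ τ) ((() , _) ∷ _) t
minSupp-immaculate q ((suc y ∷ r) ∷ τ) (y∈ ∷ _) t =
  let column , rows∧content = T-∧⁻ {strictlyIncr (suc y ∷ firstColumn τ)} t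
      rows , content        = T-∧⁻ {weaklyIncr (suc y ∷ r) ∧ allRowsWeaklyIncr τ} rows∧content
      row , other-rows      = T-∧⁻ {weaklyIncr (suc y ∷ r)} rows
      y≤rest = All.++⁺ (weaklyIncr-head≤ (suc y) r row) (concat-above-first (suc y) τ column other-rows)
  in cong (Maybe.map suc) (minSupp-contentFrom 1 q (suc y) (r ++ concat τ) y∈ y≤rest content)

-- This is where the condition min Supp p < min Supp q of ≺ comes from: the first-column
-- condition between the first row and the rest of an immaculate tableau.
first-letter≡minSuppLt : ∀ p q x r τ → All (InRange 1 (length p)) (x ∷ r) →
  All (InRange 1 (length q)) (concat τ) → T (weaklyIncr (x ∷ r)) → T (contentFrom 1 p (x ∷ r)) →
  T (isImmaculateOfContent q τ) → minSuppLt (just x) (head (firstColumn τ)) ≡ minSuppLt (minSupp p) (minSupp q)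
first-letter≡minSuppLt p q x r τ r∈ τ∈ w c t = begin
  minSuppLt (just x) (head (firstColumn τ))
    ≡⟨ sym (cong₂ minSuppLt (minSupp-weaklyIncr p x r r∈ w c) (minSupp-immaculate q τ τ∈ t)) ⟩
  minSuppLt (Maybe.map suc (minSupp p)) (Maybe.map suc (minSupp q))
    ≡⟨ minSuppLt-map suc (λ _ _ → refl) (minSupp p) (minSupp q) ⟩
  minSuppLt (minSupp p) (minSupp q) ∎
  where open ≡-Reasoning

fillings-All : ∀ {Q : ℕ → Set} α {V} → All Q V → All (All (All Q)) (fillings α V)
fillings-All []      qV = [] ∷ []
fillings-All (a ∷ α) qV =
  All-concatMap⁺ (λ (_ , qr) → All.map⁺ (All.map (qr ∷_) (fillings-All α qV))) (vecs-All a qV)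

K≡∑ : ∀ α β → K α β ≡ ∑[ τ ∈ fillings α (range 1 (length β)) ] 𝟙 (isImmaculateOfContent β τ)
K≡∑ α β = trans (countB≡∑ (isImmaculateOfContent β) (fillings α (oneTo (length β))))
               (cong (λ V → ∑[ τ ∈ fillings α V ] 𝟙 (isImmaculateOfContent β τ)) (oneTo≡range (length β)))

𝟙-immaculate-∷ : ∀ β x r τ → 𝟙 (isImmaculateOfContent β ((x ∷ r) ∷ τ)) ≡
  ∑[ (p , q) ∈ splits β ] 𝟙 (minSuppLt (just x) (head (firstColumn τ))) *
    (𝟙 (weaklyIncr (x ∷ r)) * 𝟙 (contentFrom 1 p (x ∷ r)) * 𝟙 (isImmaculateOfContent q τ))
𝟙-immaculate-∷ β x r τ = begin
  𝟙 (strictlyIncr (x ∷ firstColumn τ) ∧ ((w ∧ a) ∧ contentFrom 1 β ((x ∷ r) ++ concat τ)))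
    ≡⟨ cong (λ b → 𝟙 (b ∧ ((w ∧ a) ∧ contentFrom 1 β ((x ∷ r) ++ concat τ)))) (strictlyIncr-∷ x (firstColumn τ)) ⟩
  𝟙 ((h ∧ s) ∧ ((w ∧ a) ∧ contentFrom 1 β ((x ∷ r) ++ concat τ)))
    ≡⟨ trans (𝟙-∧ (h ∧ s) _) (cong₂ _*_ (𝟙-∧ h s) (trans (𝟙-∧ (w ∧ a) _)
         (cong₂ _*_ (𝟙-∧ w a) (𝟙-contentFrom-++ 1 β (x ∷ r) (concat τ))))) ⟩
  𝟙 h * 𝟙 s * (𝟙 w * 𝟙 a * ∑ (splits β) G)
    ≡⟨ cong (𝟙 h * 𝟙 s *_) (sym (∑-*ˡ (splits β) (𝟙 w * 𝟙 a) G)) ⟩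
  𝟙 h * 𝟙 s * (∑[ pq ∈ splits β ] 𝟙 w * 𝟙 a * G pq)
    ≡⟨ sym (∑-*ˡ (splits β) (𝟙 h * 𝟙 s) _) ⟩
  ∑[ pq ∈ splits β ] 𝟙 h * 𝟙 s * (𝟙 w * 𝟙 a * G pq)
    ≡⟨ ∑-cong (splits β) regroup ⟩
  ∑[ (p , q) ∈ splits β ] 𝟙 h * (𝟙 w * 𝟙 (contentFrom 1 p (x ∷ r)) * 𝟙 (isImmaculateOfContent q τ)) ∎
  where
  open ≡-Reasoning
  h = minSuppLt (just x) (head (firstColumn τ))
  s = strictlyIncr (firstColumn τ)
  w = weaklyIncr (x ∷ r)
  a = allRowsWeaklyIncr τ
  G : List ℕ × List ℕ → ℕ
  G (p , q) = 𝟙 (contentFrom 1 p (x ∷ r)) * 𝟙 (contentFrom 1 q (concat τ))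
  shuffle : ∀ h s w a cp cq → h * s * (w * a * (cp * cq)) ≡ h * (w * cp * (s * (a * cq)))
  shuffle = solve-∀
  regroup : ∀ pq → 𝟙 h * 𝟙 s * (𝟙 w * 𝟙 a * G pq) ≡
                   𝟙 h * (𝟙 w * 𝟙 (contentFrom 1 (proj₁ pq) (x ∷ r)) * 𝟙 (isImmaculateOfContent (proj₂ pq) τ))
  regroup (p , q) = trans (shuffle (𝟙 h) (𝟙 s) (𝟙 w) (𝟙 a) _ _)
    (cong (λ n → 𝟙 h * (𝟙 w * 𝟙 (contentFrom 1 p (x ∷ r)) * n))
          (sym (trans (𝟙-∧ s _) (cong (𝟙 s *_) (𝟙-∧ a _)))))

𝟙-*-cong-when : ∀ h h′ b c d → (T b → T c → T d → h ≡ h′) →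
  𝟙 h * (𝟙 b * 𝟙 c * 𝟙 d) ≡ 𝟙 h′ * (𝟙 b * 𝟙 c * 𝟙 d)
𝟙-*-cong-when h h′ true  true  true  eq = cong (λ h → 𝟙 h * 1) (eq _ _ _)
𝟙-*-cong-when h h′ false c     d     eq = trans (*-zeroʳ (𝟙 h)) (sym (*-zeroʳ (𝟙 h′)))
𝟙-*-cong-when h h′ true  false d     eq = trans (*-zeroʳ (𝟙 h)) (sym (*-zeroʳ (𝟙 h′)))
𝟙-*-cong-when h h′ true  true  false eq = trans (*-zeroʳ (𝟙 h)) (sym (*-zeroʳ (𝟙 h′)))

K-∷ : ∀ a α β → K (suc a ∷ α) β ≡
  ∑[ (p , q) ∈ splits β ] 𝟙 (minSuppLt (minSupp p) (minSupp q)) * (𝟙 (sum p ≡ᵇ suc a) * K α q)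
K-∷ a α β = begin
  K (suc a ∷ α) β
    ≡⟨ K≡∑ (suc a ∷ α) β ⟩
  ∑ (fillings (suc a ∷ α) V) Imm
    ≡⟨ trans (∑-concatMap _ (vecs (suc a) V) Imm) (∑-cong (vecs (suc a) V) (λ r → ∑-map (r ∷_) (fillings α V) Imm)) ⟩
  ∑[ r ∈ vecs (suc a) V ] ∑[ τ ∈ fillings α V ] Imm (r ∷ τ)
    ≡⟨ ∑-cong-All (vecs-All (suc a) V∈) (λ r (len , r∈) →
         ∑-cong-All (fillings-All α V∈) (λ τ τ∈ → expand r len r∈ τ (All.concat⁺ τ∈))) ⟩
  ∑[ r ∈ vecs (suc a) V ] ∑[ τ ∈ fillings α V ] ∑[ pq ∈ splits β ] L pq * (Row r pq * Tab τ pq)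
    ≡⟨ ∑-factor (vecs (suc a) V) (fillings α V) (splits β) L Row Tab ⟩
  ∑[ pq ∈ splits β ] L pq * ((∑[ r ∈ vecs (suc a) V ] Row r pq) * (∑[ τ ∈ fillings α V ] Tab τ pq))
    ≡⟨ ∑-cong-All (splits-All β) (λ pq (lp , lq , _) →
         cong (L pq *_) (cong₂ _*_ (rows {proj₁ pq} lp) (tableaux {proj₂ pq} lq))) ⟩
  ∑[ (p , q) ∈ splits β ] L (p , q) * (𝟙 (sum p ≡ᵇ suc a) * K α q) ∎
  where
  open ≡-Reasoning
  V = range 1 (length β)
  V∈ = range-All 1 (length β)
  Imm : List (List ℕ) → ℕ
  Imm τ = 𝟙 (isImmaculateOfContent β τ)
  L : List ℕ × List ℕ → ℕ
  L (p , q) = 𝟙 (minSuppLt (minSupp p) (minSupp q))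
  Row : List ℕ → List ℕ × List ℕ → ℕ
  Row r (p , q) = 𝟙 (weaklyIncr r) * 𝟙 (contentFrom 1 p r)
  Tab : List (List ℕ) → List ℕ × List ℕ → ℕ
  Tab τ (p , q) = 𝟙 (isImmaculateOfContent q τ)

  expand : ∀ r → length r ≡ suc a → All (InRange 1 (length β)) r → ∀ τ → All (InRange 1 (length β)) (concat τ) →
    Imm (r ∷ τ) ≡ ∑[ pq ∈ splits β ] L pq * (Row r pq * Tab τ pq)
  expand (x ∷ r) _ r∈ τ τ∈ = trans (𝟙-immaculate-∷ β x r τ) (∑-cong-All (splits-All β) λ (p , q) (lp , lq , _) →
    𝟙-*-cong-when _ _ (weaklyIncr (x ∷ r)) (contentFrom 1 p (x ∷ r)) (isImmaculateOfContent q τ)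
      (first-letter≡minSuppLt p q x r τ (subst (λ n → All (InRange 1 n) (x ∷ r)) (sym lp) r∈)
                                        (subst (λ n → All (InRange 1 n) (concat τ)) (sym lq) τ∈)))

  rows : ∀ {p} → length p ≡ length β →
    ∑[ r ∈ vecs (suc a) V ] 𝟙 (weaklyIncr r) * 𝟙 (contentFrom 1 p r) ≡ 𝟙 (sum p ≡ᵇ suc a)
  rows {p} lp =
    trans (cong (λ n → ∑[ r ∈ vecs (suc a) (range 1 n) ] 𝟙 (weaklyIncr r) * 𝟙 (contentFrom 1 p r)) (sym lp))
          (∑-weaklyIncr-content 1 p (suc a))

  tableaux : ∀ {q} → length q ≡ length β → ∑[ τ ∈ fillings α V ] 𝟙 (isImmaculateOfContent q τ) ≡ K α q
  tableaux {q} lq =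
    sym (trans (K≡∑ α q) (cong (λ n → ∑[ τ ∈ fillings α (range 1 n) ] 𝟙 (isImmaculateOfContent q τ)) lq))

-- Zero entries of the content

insertZero : ℕ → List ℕ → List ℕ
insertZero zero    e       = 0 ∷ e
insertZero (suc k) []      = []
insertZero (suc k) (x ∷ e) = x ∷ insertZero k e

insertZero² : ℕ → List ℕ × List ℕ → List ℕ × List ℕ
insertZero² k (p , q) = insertZero k p , insertZero k q

punchIn : ℕ → ℕ → ℕ
punchIn zero    i       = suc i
punchIn (suc k) zero    = zero
punchIn (suc k) (suc i) = suc (punchIn k i)

punchIn-<ᵇ : ∀ k a b → (punchIn k a <ᵇ punchIn k b) ≡ (a <ᵇ b)
punchIn-<ᵇ zero    a       b       = refl
punchIn-<ᵇ (suc k) zero    zero    = refl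
punchIn-<ᵇ (suc k) zero    (suc b) = refl
punchIn-<ᵇ (suc k) (suc a) zero    = refl
punchIn-<ᵇ (suc k) (suc a) (suc b) = punchIn-<ᵇ k a b

minSupp-insertZero : ∀ k p → minSupp (insertZero k p) ≡ Maybe.map (punchIn k) (minSupp p)
minSupp-insertZero zero    p with minSupp p
... | just i  = refl
... | nothing = refl
minSupp-insertZero (suc k) []          = refl
minSupp-insertZero (suc k) (zero ∷ p)  rewrite minSupp-insertZero k p with minSupp p
... | just i  = refl
... | nothing = refl
minSupp-insertZero (suc k) (suc a ∷ p) = refl

sum-insertZero : ∀ k p → sum (insertZero k p) ≡ sum p
sum-insertZero zero    p       = refl
sum-insertZero (suc k) []      = refl
sum-insertZero (suc k) (x ∷ p) = cong (x +_) (sum-insertZero k p)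

∑-splits-insertZero : ∀ k e (H : List ℕ × List ℕ → ℕ) →
  ∑ (splits (insertZero k e)) H ≡ ∑[ pq ∈ splits e ] H (insertZero² k pq)
∑-splits-insertZero zero    e       H = trans (∑-splits-∷ 0 e H) (+-identityʳ _)
∑-splits-insertZero (suc k) []      H = refl
∑-splits-insertZero (suc k) (x ∷ e) H =
  trans (∑-splits-∷ x (insertZero k e) H)
        (trans (∑-cong (upTo (suc x)) (λ i → ∑-splits-insertZero k e _))
               (sym (∑-splits-∷ x e (λ pq → H (insertZero² (suc k) pq)))))

K-[] : ∀ β → K [] β ≡ 𝟙 (sum β ≡ᵇ 0)
K-[] β = trans (K≡∑ [] β) (trans (+-identityʳ _) (cong 𝟙 (contentFrom-nil 1 β)))

-- Immaculate tableaux only see the relative order of the letters used.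
K-insertZero : ∀ α k e → IsComposition α → K α (insertZero k e) ≡ K α e
K-insertZero []          k e [] =
  trans (K-[] (insertZero k e)) (trans (cong (λ s → 𝟙 (s ≡ᵇ 0)) (sum-insertZero k e)) (sym (K-[] e)))
K-insertZero (suc a ∷ α) k e (_ ∷ α⁺) =
  trans (K-∷ a α (insertZero k e))
        (trans (∑-splits-insertZero k e _)
               (trans (∑-cong (splits e) λ (p , q) →
                         cong₂ (λ l n → 𝟙 l * n)
                               (trans (cong₂ minSuppLt (minSupp-insertZero k p) (minSupp-insertZero k q))
                                      (minSuppLt-map (punchIn k) (punchIn-<ᵇ k) (minSupp p) (minSupp q)))
                               (cong₂ (λ s n → 𝟙 (s ≡ᵇ suc a) * n) (sum-insertZero k p) (K-insertZero α k q α⁺)))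
                      (sym (K-∷ a α e))))

insertZero-++ : ∀ d e → insertZero (length d) (d ++ e) ≡ d ++ 0 ∷ e
insertZero-++ []      e = refl
insertZero-++ (x ∷ d) e = cong (x ∷_) (insertZero-++ d e)

K-++-compress : ∀ α d e → IsComposition α → K α (d ++ compress e) ≡ K α (d ++ e)
K-++-compress α d []          α⁺ = refl
K-++-compress α d (zero ∷ e)  α⁺ =
  trans (K-++-compress α d e α⁺)
        (trans (sym (K-insertZero α (length d) (d ++ e) α⁺)) (cong (K α) (insertZero-++ d e)))
K-++-compress α d (suc a ∷ e) α⁺ =
  trans (cong (K α) (sym (++-assoc d (suc a ∷ []) (compress e))))
        (trans (K-++-compress α (d ++ suc a ∷ []) e α⁺) (cong (K α) (++-assoc d (suc a ∷ []) e)))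

K-compress : ∀ α e → IsComposition α → K α (compress e) ≡ K α e
K-compress α = K-++-compress α []

-- Coefficients of S*

eqListᵇ⇒≡ : ∀ c β → T (eqListᵇ c β) → c ≡ β
eqListᵇ⇒≡ []      []      _ = refl
eqListᵇ⇒≡ (x ∷ c) (y ∷ β) t =
  cong₂ _∷_ (≡ᵇ⇒≡ x y (proj₁ (T-∧⁻ {x ≡ᵇ y} t))) (eqListᵇ⇒≡ c β (proj₂ (T-∧⁻ {x ≡ᵇ y} t)))

∑-vecs-eqListᵇ : ∀ j N c l → All (InRange j N) c →
  ∑[ β ∈ vecs l (range j N) ] 𝟙 (eqListᵇ c β) ≡ 𝟙 (length c ≡ᵇ l)
∑-vecs-eqListᵇ j N []      zero    _ = refl
∑-vecs-eqListᵇ j N (x ∷ c) zero    _ = refl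
∑-vecs-eqListᵇ j N []      (suc l) _ =
  trans (∑-vecs-suc l (range j N) _)
        (trans (∑-cong (range j N) (λ _ → ∑-zero (vecs l (range j N)))) (∑-zero (range j N)))
∑-vecs-eqListᵇ j N (x ∷ c) (suc l) (x∈ ∷ c∈) = begin
  ∑[ β ∈ vecs (suc l) V ] 𝟙 (eqListᵇ (x ∷ c) β)
    ≡⟨ ∑-vecs-suc l V _ ⟩
  ∑[ v ∈ V ] ∑[ w ∈ vecs l V ] 𝟙 ((x ≡ᵇ v) ∧ eqListᵇ c w)
    ≡⟨ ∑-cong V (λ v → trans (∑-cong (vecs l V) (λ w → 𝟙-∧ (x ≡ᵇ v) _)) (∑-*ˡ (vecs l V) (𝟙 (x ≡ᵇ v)) _)) ⟩
  ∑[ v ∈ V ] 𝟙 (x ≡ᵇ v) * (∑[ w ∈ vecs l V ] 𝟙 (eqListᵇ c w))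
    ≡⟨ ∑-cong V (λ v → cong (𝟙 (x ≡ᵇ v) *_) (∑-vecs-eqListᵇ j N c l c∈)) ⟩
  ∑[ v ∈ V ] 𝟙 (x ≡ᵇ v) * 𝟙 (length c ≡ᵇ l)
    ≡⟨ ∑-range-indicator-in x j N _ x∈ ⟩
  𝟙 (length c ≡ᵇ l) ∎
  where
  open ≡-Reasoning
  V = range j N

length≤sum : ∀ c → IsComposition c → length c ≤ sum c
length≤sum []      []          = z≤n
length≤sum (x ∷ c) (0<x ∷ c⁺) = +-mono-≤ 0<x (length≤sum c c⁺)

composition-InRange : ∀ c → IsComposition c → All (InRange 1 (sum c)) c
composition-InRange []      []          = []
composition-InRange (x ∷ c) (0<x ∷ c⁺) =
  (0<x , s≤s (m≤m+n x (sum c))) ∷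
  All.map (λ (1≤y , y<) → 1≤y , ≤-trans y< (s≤s (m≤n+m (sum c) x))) (composition-InRange c c⁺)

-- compositionsOf is defined by filtering these candidates by their sum.
∑-candidates-eqListᵇ : ∀ c → IsComposition c →
  ∑[ β ∈ concatMap (λ l → vecs l (oneTo (sum c))) (upTo (suc (sum c))) ] 𝟙 (eqListᵇ c β) ≡ 1
∑-candidates-eqListᵇ c c⁺ = begin
  ∑[ β ∈ concatMap (λ l → vecs l (oneTo (sum c))) (upTo (suc (sum c))) ] 𝟙 (eqListᵇ c β)
    ≡⟨ ∑-concatMap (λ l → vecs l (oneTo (sum c))) (upTo (suc (sum c))) (𝟙 ∘ eqListᵇ c) ⟩
  ∑[ l ∈ upTo (suc (sum c)) ] ∑[ β ∈ vecs l (oneTo (sum c)) ] 𝟙 (eqListᵇ c β)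
    ≡⟨ ∑-cong (upTo (suc (sum c))) count-l ⟩
  ∑[ l ∈ upTo (suc (sum c)) ] 𝟙 (length c ≡ᵇ l) * 1
    ≡⟨ cong (λ ls → ∑[ l ∈ ls ] 𝟙 (length c ≡ᵇ l) * 1) (upTo≡range (suc (sum c))) ⟩
  ∑[ l ∈ range 0 (suc (sum c)) ] 𝟙 (length c ≡ᵇ l) * 1
    ≡⟨ ∑-range-indicator-in (length c) 0 (suc (sum c)) _ (z≤n , s≤s (length≤sum c c⁺)) ⟩
  1 ∎
  where
  open ≡-Reasoning
  count-l : ∀ l → ∑[ β ∈ vecs l (oneTo (sum c)) ] 𝟙 (eqListᵇ c β) ≡ 𝟙 (length c ≡ᵇ l) * 1
  count-l l = trans (cong (λ V → ∑[ β ∈ vecs l V ] 𝟙 (eqListᵇ c β)) (oneTo≡range (sum c)))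
                    (trans (∑-vecs-eqListᵇ 1 (sum c) c l (composition-InRange c c⁺)) (sym (*-identityʳ _)))

∑-compositionsOf-eqListᵇ : ∀ (f : List ℕ → ℕ) c N → IsComposition c →
  ∑[ β ∈ compositionsOf N ] f β * 𝟙 (eqListᵇ c β) ≡ 𝟙 (sum c ≡ᵇ N) * f c
∑-compositionsOf-eqListᵇ f c N c⁺ =
  trans (∑-filterB (λ β → sum β ≡ᵇ N) candidates _)
        (trans (∑-cong candidates only-c)
               (trans (∑-*ʳ candidates (𝟙 (sum c ≡ᵇ N) * f c) (𝟙 ∘ eqListᵇ c)) (count (sum c ≡ᵇ N) refl)))
  where
  candidates = concatMap (λ l → vecs l (oneTo N)) (upTo (suc N))
  only-c : ∀ β → 𝟙 (sum β ≡ᵇ N) * (f β * 𝟙 (eqListᵇ c β)) ≡ 𝟙 (eqListᵇ c β) * (𝟙 (sum c ≡ᵇ N) * f c)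
  only-c β with eqListᵇ c β in c=β
  ... | true  rewrite eqListᵇ⇒≡ c β (subst T (sym c=β) tt) =
    trans (cong (𝟙 (sum β ≡ᵇ N) *_) (*-identityʳ (f β))) (sym (+-identityʳ _))
  ... | false = trans (cong (𝟙 (sum β ≡ᵇ N) *_) (*-zeroʳ (f β))) (*-zeroʳ (𝟙 (sum β ≡ᵇ N)))
  count : ∀ b → (sum c ≡ᵇ N) ≡ b → (∑[ β ∈ candidates ] 𝟙 (eqListᵇ c β)) * (𝟙 b * f c) ≡ 𝟙 b * f c
  count false _ = *-zeroʳ (∑[ β ∈ candidates ] 𝟙 (eqListᵇ c β))
  count true  s rewrite sym (≡ᵇ⇒≡ (sum c) N (subst T (sym s) tt)) | ∑-candidates-eqListᵇ c c⁺ = +-identityʳ _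

compress-composition : ∀ e → IsComposition (compress e)
compress-composition []          = []
compress-composition (zero ∷ e)  = compress-composition e
compress-composition (suc a ∷ e) = s≤s z≤n ∷ compress-composition e

sum-compress : ∀ e → sum (compress e) ≡ sum e
sum-compress []          = refl
sum-compress (zero ∷ e)  = sum-compress e
sum-compress (suc a ∷ e) = cong (suc a +_) (sum-compress e)

S*ℕ : List ℕ → Monomial → ℕ
S*ℕ α e = 𝟙 (sum e ≡ᵇ sum α) * K α (compress e)

+-≡ᵇ-cancelˡ : ∀ a y s → (a + y ≡ᵇ a + s) ≡ (y ≡ᵇ s)
+-≡ᵇ-cancelˡ zero    y s = refl
+-≡ᵇ-cancelˡ (suc a) y s = +-≡ᵇ-cancelˡ a y s

𝟙-≡ᵇ-+ : ∀ x y a s → 𝟙 (x + y ≡ᵇ a + s) * 𝟙 (x ≡ᵇ a) ≡ 𝟙 (x ≡ᵇ a) * 𝟙 (y ≡ᵇ s)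
𝟙-≡ᵇ-+ x y a s with x ≡ᵇ a in x=a
... | false = *-zeroʳ (𝟙 (x + y ≡ᵇ a + s))
... | true rewrite ≡ᵇ⇒≡ x a (subst T (sym x=a) tt) | +-≡ᵇ-cancelˡ a y s = trans (*-identityʳ _) (sym (+-identityʳ _))

S*ℕ-∷ : ∀ a ᾱ e → IsComposition ᾱ → S*ℕ (suc a ∷ ᾱ) e ≡
  ∑[ (p , q) ∈ splits e ] 𝟙 (minSuppLt (minSupp p) (minSupp q)) * (𝟙 (sum p ≡ᵇ suc a) * S*ℕ ᾱ q)
S*ℕ-∷ a ᾱ e ᾱ⁺ = begin
  E * K (suc a ∷ ᾱ) (compress e)
    ≡⟨ cong (E *_) (trans (K-compress (suc a ∷ ᾱ) e (s≤s z≤n ∷ ᾱ⁺)) (K-∷ a ᾱ e)) ⟩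
  E * (∑[ (p , q) ∈ splits e ] L (p , q) * (𝟙 (sum p ≡ᵇ suc a) * K ᾱ q))
    ≡⟨ sym (∑-*ˡ (splits e) E _) ⟩
  ∑[ (p , q) ∈ splits e ] E * (L (p , q) * (𝟙 (sum p ≡ᵇ suc a) * K ᾱ q))
    ≡⟨ ∑-cong-All (splits-All e) (λ (p , q) (_ , _ , sum≡) → split p q sum≡) ⟩
  ∑[ (p , q) ∈ splits e ] L (p , q) * (𝟙 (sum p ≡ᵇ suc a) * S*ℕ ᾱ q) ∎
  where
  open ≡-Reasoning
  E = 𝟙 (sum e ≡ᵇ suc a + sum ᾱ)
  L : List ℕ × List ℕ → ℕ
  L (p , q) = 𝟙 (minSuppLt (minSupp p) (minSupp q))
  shuffle : ∀ e l p k → e * (l * (p * k)) ≡ l * ((e * p) * k)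
  shuffle = solve-∀
  split : ∀ p q → sum p + sum q ≡ sum e →
    E * (L (p , q) * (𝟙 (sum p ≡ᵇ suc a) * K ᾱ q)) ≡ L (p , q) * (𝟙 (sum p ≡ᵇ suc a) * S*ℕ ᾱ q)
  split p q sum≡ = begin
    E * (L (p , q) * (P * K ᾱ q))              ≡⟨ shuffle E (L (p , q)) P (K ᾱ q) ⟩
    L (p , q) * ((E * P) * K ᾱ q)              ≡⟨ cong (λ n → L (p , q) * (n * K ᾱ q)) E*P ⟩
    L (p , q) * ((P * Q) * K ᾱ q)              ≡⟨ cong (L (p , q) *_) (*-assoc P Q (K ᾱ q)) ⟩
    L (p , q) * (P * (Q * K ᾱ q))              ≡⟨ cong (λ k → L (p , q) * (P * (Q * k))) (K-compress ᾱ q ᾱ⁺) ⟨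
    L (p , q) * (P * (Q * K ᾱ (compress q)))   ∎
    where
    P = 𝟙 (sum p ≡ᵇ suc a)
    Q = 𝟙 (sum q ≡ᵇ sum ᾱ)
    E*P : E * P ≡ P * Q
    E*P = trans (cong (λ s → 𝟙 (s ≡ᵇ suc a + sum ᾱ) * P) (sym sum≡)) (𝟙-≡ᵇ-+ (sum p) (sum q) (suc a) (sum ᾱ))

module Coefficients {c ℓ : Level} (R : CommutativeRing c ℓ) where
  open CommutativeRing R
    using (Carrier; _≈_; 0#; 1#; +-cong; *-cong; zeroˡ; distribʳ)
    renaming (_+_ to _⊕_; _*_ to _⊛_; refl to ≈-refl; sym to ≈-sym; trans to ≈-trans; reflexive to ≈-reflexive;
              +-assoc to ⊕-assoc; +-identityˡ to ⊕-identityˡ; +-identityʳ to ⊕-identityʳ; *-identityˡ to ⊛-identityˡ)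
  open PowerSeries R

  fromℕ-+ : ∀ m n → fromℕ (m + n) ≈ fromℕ m ⊕ fromℕ n
  fromℕ-+ zero    n = ≈-sym (⊕-identityˡ (fromℕ n))
  fromℕ-+ (suc m) n = ≈-trans (+-cong ≈-refl (fromℕ-+ m n)) (≈-sym (⊕-assoc 1# (fromℕ m) (fromℕ n)))

  fromℕ-* : ∀ m n → fromℕ (m * n) ≈ fromℕ m ⊛ fromℕ n
  fromℕ-* zero    n = ≈-sym (zeroˡ (fromℕ n))
  fromℕ-* (suc m) n = ≈-trans (fromℕ-+ n (m * n))
    (≈-trans (+-cong (≈-sym (⊛-identityˡ (fromℕ n))) (fromℕ-* m n)) (≈-sym (distribʳ (fromℕ n) 1# (fromℕ m))))

  sumR-fromℕ : ∀ {A : Set} (f : A → Carrier) (g : A → ℕ) xs →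
    (∀ x → f x ≈ fromℕ (g x)) → sumR (map f xs) ≈ fromℕ (∑ xs g)
  sumR-fromℕ f g []       f≈g = ≈-refl
  sumR-fromℕ f g (x ∷ xs) f≈g = ≈-trans (+-cong (f≈g x) (sumR-fromℕ f g xs f≈g)) (≈-sym (fromℕ-+ (g x) (∑ xs g)))

  if-fromℕ : ∀ b {X} n → X ≈ fromℕ n → (if b then X else 0#) ≈ fromℕ (𝟙 b * n)
  if-fromℕ true  n X≈n = ≈-trans X≈n (≈-reflexive (cong fromℕ (sym (+-identityʳ n))))
  if-fromℕ false n X≈n = ≈-refl

  indicator≈fromℕ : ∀ b → (if b then 1# else 0#) ≈ fromℕ (𝟙 b)
  indicator≈fromℕ true  = ≈-sym (⊕-identityʳ 1#)
  indicator≈fromℕ false = ≈-refl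

  h≈fromℕ : ∀ n e → h n e ≈ fromℕ (𝟙 (sum e ≡ᵇ n))
  h≈fromℕ n e = indicator≈fromℕ (sum e ≡ᵇ n)

  S*≈fromℕ : ∀ α e → S* α e ≈ fromℕ (S*ℕ α e)
  S*≈fromℕ α e = ≈-trans
    (sumR-fromℕ _ (λ β → K α β * 𝟙 (eqListᵇ (compress e) β)) (compositionsOf (sum α)) (λ β →
       ≈-trans (*-cong ≈-refl (indicator≈fromℕ (eqListᵇ (compress e) β))) (≈-sym (fromℕ-* (K α β) _))))
    (≈-reflexive (cong fromℕ (trans (∑-compositionsOf-eqListᵇ (K α) (compress e) (sum α) (compress-composition e))
                                    (cong (λ s → 𝟙 (s ≡ᵇ sum α) * K α (compress e)) (sum-compress e)))))

  ≺-fromℕ : ∀ {f g : PS} {F G : Monomial → ℕ} → (∀ e → f e ≈ fromℕ (F e)) → (∀ e → g e ≈ fromℕ (G e)) →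
    ∀ e → (f ≺ g) e ≈ fromℕ (∑[ (p , q) ∈ splits e ] 𝟙 (minSuppLt (minSupp p) (minSupp q)) * (F p * G q))
  ≺-fromℕ {F = F} {G} f≈F g≈G e = sumR-fromℕ _ _ (splits e) λ (p , q) →
    if-fromℕ (minSuppLt (minSupp p) (minSupp q)) (F p * G q)
             (≈-trans (*-cong (f≈F p) (g≈G q)) (≈-sym (fromℕ-* (F p) (G q))))

corollary4p6 : ∀ {c ℓ} (R : CommutativeRing c ℓ) (a : ℕ) (ᾱ : List ℕ) →
    IsComposition (a ∷ ᾱ) →
    PowerSeries._≐_ R (PowerSeries.S* R (a ∷ ᾱ)) (PowerSeries._≺_ R (PowerSeries.h R a) (PowerSeries.S* R ᾱ))
corollary4p6 R (suc a) ᾱ (_ ∷ ᾱ⁺) e = begin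
  S* (suc a ∷ ᾱ) e
    ≈⟨ S*≈fromℕ (suc a ∷ ᾱ) e ⟩
  fromℕ (S*ℕ (suc a ∷ ᾱ) e)
    ≡⟨ cong fromℕ (S*ℕ-∷ a ᾱ e ᾱ⁺) ⟩
  fromℕ (∑[ (p , q) ∈ splits e ] 𝟙 (minSuppLt (minSupp p) (minSupp q)) * (𝟙 (sum p ≡ᵇ suc a) * S*ℕ ᾱ q))
    ≈⟨ ≺-fromℕ {F = λ p → 𝟙 (sum p ≡ᵇ suc a)} {G = S*ℕ ᾱ} (h≈fromℕ (suc a)) (S*≈fromℕ ᾱ) e ⟨
  (h (suc a) ≺ S* ᾱ) e ∎
  where
  open PowerSeries R
  open Coefficients R
  open import Relation.Binary.Reasoning.Setoid (CommutativeRing.setoid R)
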